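{- Let $(G,A)$ be a simple edge-weighted graph with vertices $v_1,\dots,v_n$, and let $\{G_n,\dots,G_1\}$ be a complete collapse sequence of $(G,A)$. For $2\le i\le n$ define $\phi_i:S_{G_i}\to S_{G_{i-1}}$ by $\phi_i(g_1,\dots,g_i)=(g_1,\dots,g_{i-1})$, and define $\phi_1:S_{G_1}\to 0$ by $\phi_1(g_1)=0$; let $K_i=\ker\phi_i$. Then: (1) $S_G\cong K_1\oplus K_2\oplus\cdots\oplus K_n$ as $\mathbb{Z}$-modules. (2) Each $K_i$ is a rank $1$ submodule of $S_{G_i}$. (3) For $i>1$, let $c_1,\dots,c_d$ be the weights of the edges incident to $v_i$ in $G_i$. Then $m_1=(1)$ generates $K_1$, and $m_i=(0,0,\dots,0,\operatorname{lcm}(c_1,\dots,c_d))\in\mathbb{Z}^i$ generates $K_i$ for $i>1$. (4) For each $i<n$ let $M_i\in S_G$ be a pre-image of $m_i$ under $\phi_{i+1}\circ\cdots\circ\phi_{n-1}\circ\phi_n$, and let $M_n=m_n$. Then $\{M_1,\dots,M_n\}$ is a flow-up class basis of $S_G$, with $M_i\in\mathcal{F}_{i-1}$ for each $i$.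
   Context: An edge-weighted graph $(G,A)$ is a finite loopless graph $G$ (multiple edges allowed unless "simple" is stated) with vertex set $\{v_1,\dots,v_n\}$ and edge set $E$, together with a weight function $A:E\to\mathbb{Z}_{>0}$. A spline on $(G,A)$ is a tuple $(g_1,\dots,g_n)\in\mathbb{Z}^n$ such that $g_i\equiv g_j \pmod{A(e)}$ for every edge $e$ joining $v_i$ and $v_j$. The set of splines, $S_G$, is a $\mathbb{Z}$-submodule of $\mathbb{Z}^n$. A graph with one vertex and no edges has $S_{G}=\mathbb{Z}$. Star-clique operation: for a simple $(G,A)$ and a vertex $v$ with (distinct) neighbours $w_1,\dots,w_d$, where the edge $vw_k$ has weight $a_k$, the graph $(G_v,A_v)$ is obtained by deleting $v$ and all edges incident to $v$, and then, for each pair $j<k$, adding a new edge between $w_j$ and $w_k$ of weight $\gcd(a_j,a_k)$ (even if $w_j,w_k$ were already adjacent, which may create multiple edges); all other vertices and edges are unchanged. Edge-collapse operation: if edges $e_1,\dots,e_r$ ($r\ge2$) all join the same pair of vertices and have weights $a_1,\dots,a_r$, replace them by a single edge joining that pair with weight $\operatorname{lcm}(a_1,\dots,a_r)$. A complete collapse sequence of a simple $(G,A)$ with vertices $v_1,\dots,v_n$ is a sequence of simple edge-weighted graphs $G_n=G, G_{n-1},\dots,G_1$ where, for $2\le i\le n$, $G_{i-1}$ is obtained from $G_i$ by applying the star-clique operation to $v_i$ and then edge-collapsing all multiple edges; thus $G_i$ has vertices $v_1,\dots,v_i$ and $G_1$ is the single vertex $v_1$. Flow-up classes: for $0\le i<n$,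 $\mathcal{F}_i\subseteq S_G$ is the set of splines $(g_1,\dots,g_n)$ with $g_1=\cdots=g_i=0$ and $g_{i+1}\neq0$; $\mathcal{F}_n=\{0\}$. For $F\in\mathcal{F}_i$ ($i<n$) the leading term is $L(F)=g_{i+1}$. A minimal element of $\mathcal{F}_i$ is $B\in\mathcal{F}_i$ with $L(B)>0$ and $L(B)\le|L(F)|$ for all $F\in\mathcal{F}_i$. A flow-up class basis of $S_G$ is a $\mathbb{Z}$-basis $\{B_0,\dots,B_{n-1}\}$ of $S_G$ with each $B_i$ a minimal element of $\mathcal{F}_i$. The lcm of an empty set of integers is taken to be $1$. -}

module Defs where

open import Data.Nat using (ℕ; zero; suc; _∸_; _<_; _≟_; _≡ᵇ_)
open import Data.Nat.GCD using (gcd)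
open import Data.Nat.LCM using (lcm)
open import Data.Integer as ℤ using (ℤ; +_; 0ℤ; _≤_)
open import Data.Integer.Divisibility using (_∣_)
open import Data.Fin using (Fin; toℕ; inject≤; zero; suc)
open import Data.Fin.Properties using (toℕ<n)
open import Data.List using (List; filter; map; upTo; foldr)
open import Data.Bool using (if_then_else_)
open import Data.Product using (Σ; ∃; _×_)
open import Relation.Nullary using (¬_; ¬?)
open import Relation.Binary.PropositionalEquality using (_≡_; _≢_)

-- A weight function W : ℕ → ℕ → ℕ on a graph with k vertices
-- v_1,…,v_k (indexed 0,…,k-1): only the entries W a b with a,b < k are
-- relevant.  W a b ≡ 0 means "no edge between a and b"; W a b = c > 0
-- means there is an edge of (positive) weight c.

Wt : Set
Wt = ℕ → ℕ → ℕ

IsSimple : ℕ → Wt → Set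
IsSimple n W = (∀ a b → a < n → b < n → W a b ≡ W b a) × (∀ a → a < n → W a a ≡ 0)

Vect : ℕ → Set
Vect k = Fin k → ℤ

IsSpline : (k : ℕ) → Wt → Vect k → Set
IsSpline k W g = ∀ (a b : Fin k) → W (toℕ a) (toℕ b) ≢ 0 →
                 (+ W (toℕ a) (toℕ b)) ∣ (g a ℤ.- g b)

_≋_ : ∀ {k} → Vect k → Vect k → Set
g ≋ h = ∀ a → g a ≡ h a

_⊕_ : ∀ {k} → Vect k → Vect k → Vect k
(g ⊕ h) a = g a ℤ.+ h a

_·_ : ∀ {k} → ℤ → Vect k → Vect k
(c · g) a = c ℤ.* g a

-- lcm of two "optional" edge weights (0 = no edge): collapsing a
-- possibly absent old edge with a possibly absent new edge.
comb : ℕ → ℕ → ℕ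
comb zero b = b
comb (suc a) zero = suc a
comb (suc a) (suc b) = lcm (suc a) (suc b)

-- the new edge created between two neighbours of the removed vertex
-- (absent unless both are neighbours), of weight gcd.
newEdge : ℕ → ℕ → ℕ
newEdge zero _ = 0
newEdge (suc a) zero = 0
newEdge (suc a) (suc b) = gcd (suc a) (suc b)

-- collapse s W : from the graph W on vertices 0..s, remove vertex s by the
-- star-clique operation and edge-collapse all multiple edges; result is a
-- graph on vertices 0..s-1.
collapse : ℕ → Wt → Wt
collapse s W a b = if a ≡ᵇ b then 0 else comb (W a b) (newEdge (W a s) (W b s))

-- lev n W d = G_{n-d} in the complete collapse sequence of (W on n vertices)
lev : ℕ → Wt → ℕ → Wt
lev n W zero = W
lev n W (suc d) = collapse (n ∸ suc d) (lev n W d)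

-- For i : Fin n (0-based), G n W i is the graph G_{i+1} (vertices 0..i).
G : (n : ℕ) → Wt → Fin n → Wt
G n W i = lev n W (n ∸ suc (toℕ i))

-- Kernel K_{i+1} of φ_{i+1} : S_{G_{i+1}} → S_{G_i} (restriction), as a
-- subset of ℤ^{i+1}; for i = 0 this is all of S_{G_1}.

InK : (n : ℕ) → Wt → (i : Fin n) → Vect (suc (toℕ i)) → Set
InK n W i g = IsSpline (suc (toℕ i)) (G n W i) g
            × (∀ (a : Fin (suc (toℕ i))) → toℕ a < toℕ i → g a ≡ 0ℤ)

incidentWeights : Wt → ℕ → List ℕ
incidentWeights H s = filter (λ x → ¬? (x ≟ 0)) (map (λ j → H j s) (upTo s))

lcmList : List ℕ → ℕ
lcmList = foldr lcm 1

-- m_{i+1} = (0,…,0, lcm of incident edge weights) ∈ ℤ^{i+1};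
-- for i = 0 the list is empty and this is (1).
mvec : (n : ℕ) → Wt → (i : Fin n) → Vect (suc (toℕ i))
mvec n W i a = if toℕ a ≡ᵇ toℕ i
               then + lcmList (incidentWeights (G n W i) (toℕ i))
               else 0ℤ

Generates : ∀ {k} → (Vect k → Set) → Vect k → Set
Generates P v = P v × (∀ g → P g → ∃ λ (c : ℤ) → g ≋ (c · v))

Rank1 : ∀ {k} → (Vect k → Set) → Set
Rank1 {k} P = Σ (ℤ → Vect k) λ f →
    (∀ c → P (f c))
  × (∀ c d → f (c ℤ.+ d) ≋ (f c ⊕ f d))
  × (∀ c d → f (c ℤ.* d) ≋ (c · f d))
  × (∀ c d → f c ≋ f d → c ≡ d)
  × (∀ g → P g → ∃ λ c → f c ≋ g)

-- external direct sum K_1 ⊕ ⋯ ⊕ K_n: families y with y i ∈ K_{i+1}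
SumVect : ℕ → Set
SumVect n = (i : Fin n) → Vect (suc (toℕ i))

_≋Σ_ : ∀ {n} → SumVect n → SumVect n → Set
x ≋Σ y = ∀ i → x i ≋ y i

IsoToSum : (n : ℕ) → Wt → Set
IsoToSum n W = Σ (Vect n → SumVect n) λ Φ →
    (∀ g → IsSpline n W g → ∀ i → InK n W i (Φ g i))
  × (∀ g h → IsSpline n W g → IsSpline n W h → g ≋ h → Φ g ≋Σ Φ h)
  × (∀ g h → IsSpline n W g → IsSpline n W h → Φ (g ⊕ h) ≋Σ (λ i → Φ g i ⊕ Φ h i))
  × (∀ c g → IsSpline n W g → Φ (c · g) ≋Σ (λ i → c · Φ g i))
  × (∀ g h → IsSpline n W g → IsSpline n W h → Φ g ≋Σ Φ h → g ≋ h)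
  × (∀ y → (∀ i → InK n W i (y i)) → ∃ λ g → IsSpline n W g × Φ g ≋Σ y)

sumFin : ∀ {m} → (Fin m → ℤ) → ℤ
sumFin {zero} f = 0ℤ
sumFin {suc m} f = f zero ℤ.+ sumFin (λ j → f (suc j))

lincomb : ∀ {n} → (Fin n → ℤ) → (Fin n → Vect n) → Vect n
lincomb c B a = sumFin (λ j → c j ℤ.* B j a)

-- F_i (0 ≤ i < n): splines with g_1 = ⋯ = g_i = 0 and g_{i+1} ≠ 0
-- (1-based), i.e. coordinates < i vanish and coordinate i is nonzero (0-based).
InF : (n : ℕ) → Wt → Fin n → Vect n → Set
InF n W i g = IsSpline n W g × (∀ a → toℕ a < toℕ i → g a ≡ 0ℤ) × g i ≢ 0ℤ

-- minimal element of F_i; leading term L(g) = g i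
Minimal : (n : ℕ) → Wt → Fin n → Vect n → Set
Minimal n W i B = InF n W i B × (+ 0 ℤ.< B i)
                × (∀ F → InF n W i F → B i ≤ + ℤ.∣ F i ∣)

IsZBasis : (n : ℕ) → Wt → (Fin n → Vect n) → Set
IsZBasis n W B = (∀ j → IsSpline n W (B j))
  × (∀ c → lincomb c B ≋ (λ _ → 0ℤ) → ∀ j → c j ≡ 0ℤ)
  × (∀ g → IsSpline n W g → ∃ λ c → g ≋ lincomb c B)

-- B j is the flow-up basis element B_j (j = 0,…,n-1), minimal in F_j
IsFlowUpBasis : (n : ℕ) → Wt → (Fin n → Vect n) → Set
IsFlowUpBasis n W B = IsZBasis n W B × (∀ j → Minimal n W j (B j))

-- restriction of g ∈ ℤ^n to the first i+1 coordinates
-- (= φ_{i+2} ∘ ⋯ ∘ φ_n applied to g)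
restrict : ∀ {n} → (i : Fin n) → Vect n → Vect (suc (toℕ i))
restrict i g a = g (inject≤ a (toℕ<n i))

-- Deleting the last vertex s of G_{s+1} by the star-clique operation and collapsing
-- multiple edges is exactly what makes the restriction S_{G_{s+1}} → S_{G_s} onto:
-- the new gcd-weighted edges make a spline on G_s satisfy the pairwise compatibility
-- conditions of the congruences x ≡ g_a (mod c_a) over the neighbours a of s, so the
-- generalised Chinese remainder theorem supplies a value at s. The kernel consists of
-- the vectors (0,…,0,x), and the edge conditions at s say exactly that lcm(c_1,…,c_d)
-- divides x. Lifting the kernel generators along the restrictions gives a triangular
-- family of splines with these lcms on the diagonal; since every spline vanishing on
-- the first i vertices has (i+1)-st entry divisible by the corresponding lcm, such a
-- family is a basis of flow-up classes, each minimal in its class, and coordinates in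
-- it split S_G as the direct sum of the kernels.

module Submission where

open import Defs

open import Data.Nat as ℕ using (ℕ; zero; suc; _<_; _≤_; _∸_; s≤s; _≡ᵇ_)
import Data.Nat.Properties as ℕₚ
open import Data.Nat.Divisibility as ℕ∣ using () renaming (_∣_ to _∣ℕ_)
open import Data.Nat.GCD
  using (gcd; gcd[m,n]∣m; gcd[m,n]∣n; gcd-greatest; gcd-comm; gcd-zeroʳ; gcd[m,n]≡0⇒m≡0;
         c*gcd[m,n]≡gcd[cm,cn]; gcd-GCD; module Bézout)
open import Data.Nat.LCM using (lcm; m∣lcm[m,n]; n∣lcm[m,n]; lcm-least; gcd*lcm)
open import Data.Integer as ℤ using (ℤ; +_; 0ℤ; 1ℤ; -1ℤ; _+_; _-_; _*_; -_; ∣_∣)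
import Data.Integer.Properties as ℤₚ
open import Data.Integer.Divisibility.Signed as ℤ∣ using (_∣_; divides)
open import Data.Integer.Tactic.RingSolver using (solve-∀)
open import Data.Fin as Fin using (Fin; zero; suc; toℕ; fromℕ; fromℕ<; inject≤; punchIn)
import Data.Fin.Properties as Fₚ
open import Data.Fin.Properties using (punchInᵢ≢i)
open import Data.Fin.Induction using (<-wellFounded)
open import Data.Bool using (true; false; if_then_else_)
open import Data.Product using (∃; ∃₂; _×_; _,_; proj₁; proj₂)
open import Data.Sum using (_⊎_; inj₁; inj₂; [_,_]′)
open import Data.Empty using (⊥-elim)
open import Data.List.Properties using (foldr-preservesᵇ; foldr-preservesᵒ)
import Data.List.Relation.Unary.All as ListAll
import Data.List.Relation.Unary.Any as Any
open import Data.List.Membership.Propositional using (_∈_)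
import Data.List.Membership.Propositional.Properties as ∈ₚ
open import Algebra.Properties.Semiring.Sum ℤₚ.+-*-semiring
  using (sum; sum-cong-≗; ∑-distrib-+; *-distribˡ-sum; sum-remove; sum-replicate-zero)
open import Function using (_∘_)
open import Level using (0ℓ)
open import Induction.WellFounded using (module All)
open import Relation.Nullary using (¬?; yes; no; Dec; does)
open import Relation.Nullary.Decidable using (dec-true; dec-false; _→-dec_)
open import Relation.Binary.Definitions using (tri<; tri≈; tri>)
open import Relation.Binary.PropositionalEquality



lcm≢0 : ∀ m n → m ≢ 0 → n ≢ 0 → lcm m n ≢ 0
lcm≢0 m n m≢0 n≢0 lcm≡0 = [ m≢0 , n≢0 ]′ (ℕₚ.m*n≡0⇒m≡0∨n≡0 m m*n≡0)
  where
  m*n≡0 : m ℕ.* n ≡ 0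
  m*n≡0 = trans (sym (gcd*lcm m n)) (trans (cong (gcd m n ℕ.*_) lcm≡0) (ℕₚ.*-zeroʳ (gcd m n)))

-- With x = gcd m a, y = gcd m b, z = gcd x y and d = gcd m (lcm a b), the product d * z
-- divides m*m, m*b, a*m and a*b = lcm a b * gcd a b, hence y*m, y*a and y*x; as
-- y * x = z * lcm x y and z ≢ 0, cancelling z gives the claim.
gcd-lcm-∣-lcm-gcd : ∀ m a b → m ≢ 0 → gcd m (lcm a b) ∣ℕ lcm (gcd m a) (gcd m b)
gcd-lcm-∣-lcm-gcd m a b m≢0 = ℕ∣.*-cancelˡ-∣ z {{ℕ.≢-nonZero z≢0}} z*d∣z*l
  where
  x y z d : ℕ
  x = gcd m a
  y = gcd m b
  z = gcd x y
  d = gcd m (lcm a b)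
  z≢0 : z ≢ 0
  z≢0 z≡0 = m≢0 (gcd[m,n]≡0⇒m≡0 (gcd[m,n]≡0⇒m≡0 z≡0))
  z∣m : z ∣ℕ m
  z∣m = ℕ∣.∣-trans (gcd[m,n]∣m x y) (gcd[m,n]∣m m a)
  z∣a : z ∣ℕ a
  z∣a = ℕ∣.∣-trans (gcd[m,n]∣m x y) (gcd[m,n]∣n m a)
  z∣b : z ∣ℕ b
  z∣b = ℕ∣.∣-trans (gcd[m,n]∣n x y) (gcd[m,n]∣n m b)
  d∣m : d ∣ℕ m
  d∣m = gcd[m,n]∣m m (lcm a b)
  dz∣mm : d ℕ.* z ∣ℕ m ℕ.* m
  dz∣mm = ℕ∣.*-pres-∣ d∣m z∣m
  dz∣mb : d ℕ.* z ∣ℕ m ℕ.* b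
  dz∣mb = ℕ∣.*-pres-∣ d∣m z∣b
  dz∣am : d ℕ.* z ∣ℕ a ℕ.* m
  dz∣am = subst (d ℕ.* z ∣ℕ_) (ℕₚ.*-comm m a) (ℕ∣.*-pres-∣ d∣m z∣a)
  dz∣ab : d ℕ.* z ∣ℕ a ℕ.* b
  dz∣ab = subst (d ℕ.* z ∣ℕ_) (trans (ℕₚ.*-comm (lcm a b) (gcd a b)) (gcd*lcm a b))
            (ℕ∣.*-pres-∣ (gcd[m,n]∣n m (lcm a b)) (gcd-greatest z∣a z∣b))
  dz∣my : d ℕ.* z ∣ℕ m ℕ.* y
  dz∣my = subst (d ℕ.* z ∣ℕ_) (sym (c*gcd[m,n]≡gcd[cm,cn] m m b)) (gcd-greatest dz∣mm dz∣mb)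
  dz∣ay : d ℕ.* z ∣ℕ a ℕ.* y
  dz∣ay = subst (d ℕ.* z ∣ℕ_) (sym (c*gcd[m,n]≡gcd[cm,cn] a m b)) (gcd-greatest dz∣am dz∣ab)
  dz∣yx : d ℕ.* z ∣ℕ y ℕ.* x
  dz∣yx = subst (d ℕ.* z ∣ℕ_) (sym (c*gcd[m,n]≡gcd[cm,cn] y m a))
            (gcd-greatest (subst (d ℕ.* z ∣ℕ_) (ℕₚ.*-comm m y) dz∣my)
                          (subst (d ℕ.* z ∣ℕ_) (ℕₚ.*-comm a y) dz∣ay))
  z*d∣z*l : z ℕ.* d ∣ℕ z ℕ.* lcm x y
  z*d∣z*l = subst₂ _∣ℕ_ (ℕₚ.*-comm d z) (trans (ℕₚ.*-comm y x) (sym (gcd*lcm x y))) dz∣yx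

lcmList-least : ∀ {N} l → (∀ {x} → x ∈ l → x ∣ℕ N) → lcmList l ∣ℕ N
lcmList-least {N} l h = foldr-preservesᵇ {P = _∣ℕ N} {f = lcm} lcm-least (ℕ∣.1∣ N) (ListAll.tabulate h)

lcmList≢0 : ∀ l → (∀ {x} → x ∈ l → x ≢ 0) → lcmList l ≢ 0
lcmList≢0 l h = foldr-preservesᵇ {P = _≢ 0} {f = lcm} (λ {x} {y} → lcm≢0 x y) (λ ()) (ListAll.tabulate h)

∈⇒∣lcmList : ∀ {x} l → x ∈ l → x ∣ℕ lcmList l
∈⇒∣lcmList {x} l x∈l =
  foldr-preservesᵒ {P = x ∣ℕ_} {f = lcm} ∣lcm 1 l (inj₂ (Any.map (λ { refl → ℕ∣.∣-refl }) x∈l))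
  where
  ∣lcm : ∀ a b → x ∣ℕ a ⊎ x ∣ℕ b → x ∣ℕ lcm a b
  ∣lcm a b (inj₁ x∣a) = ℕ∣.∣-trans x∣a (m∣lcm[m,n] a b)
  ∣lcm a b (inj₂ x∣b) = ℕ∣.∣-trans x∣b (n∣lcm[m,n] a b)

ℕ-eq⇒ℤ-sub : ∀ {d p q r s} → d ℕ.+ p ℕ.* q ≡ r ℕ.* s → + d ≡ + r * + s - + p * + q
ℕ-eq⇒ℤ-sub {d} {p} {q} {r} {s} eq = begin
  + d                            ≡⟨ add-sub (+ d) (+ p * + q) ⟩
  + d + + p * + q - + p * + q    ≡⟨ cong (λ e → + d + e - + p * + q) (sym (ℤₚ.pos-* p q)) ⟩
  + (d ℕ.+ p ℕ.* q) - + p * + q  ≡⟨ cong (λ e → + e - + p * + q) eq ⟩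
  + (r ℕ.* s) - + p * + q        ≡⟨ cong (_- + p * + q) (ℤₚ.pos-* r s) ⟩
  + r * + s - + p * + q          ∎
  where
  open ≡-Reasoning
  add-sub : ∀ x y → x ≡ x + y - y
  add-sub = solve-∀

bézout : ∀ a b → ∃₂ λ u w → + gcd a b ≡ u * + a + w * + b
bézout a b with Bézout.identity (gcd-GCD a b)
... | Bézout.+- x y eq =
  + x , - + y , trans (ℕ-eq⇒ℤ-sub {gcd a b} {y} {b} {x} {a} eq) (rearrange (+ x) (+ a) (+ y) (+ b))
  where
  rearrange : ∀ X A Y B → X * A - Y * B ≡ X * A + (- Y) * B
  rearrange = solve-∀
... | Bézout.-+ x y eq =
  - + x , + y , trans (ℕ-eq⇒ℤ-sub {gcd a b} {x} {a} {y} {b} eq) (rearrange (+ y) (+ b) (+ x) (+ a))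
  where
  rearrange : ∀ Y B X A → Y * B - X * A ≡ (- X) * A + Y * B
  rearrange = solve-∀

crt₂ : ∀ L m N → gcd L m ∣ℕ ∣ N ∣ → ∃ λ t → + m ∣ N - + L * t
crt₂ L m N g∣N with bézout L m | ℤ∣.∣ᵤ⇒∣ {+ gcd L m} {N} g∣N
... | u , w , g≡ | divides q N≡q*g = q * u , divides (q * w) (begin
  N - + L * (q * u)                          ≡⟨ cong (λ e → e - + L * (q * u)) N≡q*g ⟩
  q * + gcd L m - + L * (q * u)              ≡⟨ cong (λ e → q * e - + L * (q * u)) g≡ ⟩
  q * (u * + L + w * + m) - + L * (q * u)    ≡⟨ cancel q u w (+ L) (+ m) ⟩
  q * w * + m                                ∎)
  where
  open ≡-Reasoning
  cancel : ∀ q u w L m → q * (u * L + w * m) - L * (q * u) ≡ q * w * m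
  cancel = solve-∀


-- An edge weight 0 stands for a missing edge, which imposes no condition.
infix 4 _∣₀_
_∣₀_ : ℕ → ℤ → Set
w ∣₀ z = w ≢ 0 → + w ∣ z

+∣+ : ∀ {a b} → a ∣ℕ b → + a ∣ + b
+∣+ = ℤ∣.∣ᵤ⇒∣

∣-x-x : ∀ k x → k ∣ x - x
∣-x-x k x = divides 0ℤ (trans (ℤₚ.+-inverseʳ x) (sym (ℤₚ.*-zeroˡ k)))

∣₀-swap : ∀ w p q → w ∣₀ p - q → w ∣₀ q - p
∣₀-swap w p q h w≢0 = subst (_ ∣_) (negate-sub p q) (ℤ∣.∣m⇒∣-m (h w≢0))
  where
  negate-sub : ∀ p q → - (p - q) ≡ q - p
  negate-sub = solve-∀

comb≢0ˡ : ∀ p q → p ≢ 0 → comb p q ≢ 0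
comb≢0ˡ zero    q       p≢0 = ⊥-elim (p≢0 refl)
comb≢0ˡ (suc p) zero    _   = λ ()
comb≢0ˡ (suc p) (suc q) _   = lcm≢0 (suc p) (suc q) (λ ()) (λ ())

gcd-comb-∣ : ∀ {m N} a b → m ≢ 0 → a ≢ 0 → gcd m a ∣ℕ N → (b ≢ 0 → gcd m b ∣ℕ N) →
             gcd m (comb a b) ∣ℕ N
gcd-comb-∣ zero    b       _   a≢0 _  _  = ⊥-elim (a≢0 refl)
gcd-comb-∣ (suc a) zero    _   _   ha _  = ha
gcd-comb-∣ {m} (suc a) (suc b) m≢0 _ ha hb =
  ℕ∣.∣-trans (gcd-lcm-∣-lcm-gcd m (suc a) (suc b) m≢0) (lcm-least ha (hb λ ()))

comb-∣₀ : ∀ p q {z} → p ∣₀ z → q ∣₀ z → comb p q ∣₀ z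
comb-∣₀ zero    q       _  hq = hq
comb-∣₀ (suc p) zero    hp _  = hp
comb-∣₀ (suc p) (suc q) hp hq _ =
  ℤ∣.∣ᵤ⇒∣ (lcm-least (ℤ∣.∣⇒∣ᵤ (hp λ ())) (ℤ∣.∣⇒∣ᵤ (hq λ ())))

comb-∣₀ˡ : ∀ p q {z} → comb p q ∣₀ z → p ∣₀ z
comb-∣₀ˡ zero    q       _ p≢0 = ⊥-elim (p≢0 refl)
comb-∣₀ˡ (suc p) zero    h _   = h λ ()
comb-∣₀ˡ (suc p) (suc q) h _   =
  ℤ∣.∣-trans (+∣+ (m∣lcm[m,n] (suc p) (suc q))) (h (lcm≢0 (suc p) (suc q) (λ ()) (λ ())))

comb-∣₀ʳ : ∀ p q {z} → comb p q ∣₀ z → q ∣₀ z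
comb-∣₀ʳ zero    q       h     = h
comb-∣₀ʳ (suc p) zero    _ q≢0 = ⊥-elim (q≢0 refl)
comb-∣₀ʳ (suc p) (suc q) h _   =
  ℤ∣.∣-trans (+∣+ (n∣lcm[m,n] (suc p) (suc q))) (h (lcm≢0 (suc p) (suc q) (λ ()) (λ ())))

newEdge-∣₀ : ∀ p q {x y} → p ∣₀ x → q ∣₀ y → newEdge p q ∣₀ x - y
newEdge-∣₀ zero    q       _  _  ne = ⊥-elim (ne refl)
newEdge-∣₀ (suc p) zero    _  _  ne = ⊥-elim (ne refl)
newEdge-∣₀ (suc p) (suc q) hp hq _  =
  ℤ∣.∣m∣n⇒∣m-n (ℤ∣.∣-trans (+∣+ (gcd[m,n]∣m (suc p) (suc q))) (hp λ ()))
               (ℤ∣.∣-trans (+∣+ (gcd[m,n]∣n (suc p) (suc q))) (hq λ ()))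

newEdge-∣₀⇒gcd-∣ : ∀ p q {z} → p ≢ 0 → q ≢ 0 → newEdge p q ∣₀ z → + gcd p q ∣ z
newEdge-∣₀⇒gcd-∣ zero    q       p≢0 _   _ = ⊥-elim (p≢0 refl)
newEdge-∣₀⇒gcd-∣ (suc p) zero    _   q≢0 _ = ⊥-elim (q≢0 refl)
newEdge-∣₀⇒gcd-∣ (suc p) (suc q) _   _   h = h (λ gcd≡0 → ℕₚ.1+n≢0 (gcd[m,n]≡0⇒m≡0 {suc p} {suc q} gcd≡0))

newEdge-comm : ∀ p q → newEdge p q ≡ newEdge q p
newEdge-comm zero    zero    = refl
newEdge-comm zero    (suc q) = refl
newEdge-comm (suc p) zero    = refl
newEdge-comm (suc p) (suc q) = gcd-comm (suc p) (suc q)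


-- The Chinese remainder theorem

-- comb skips zero moduli, so this is the lcm of the nonzero m a with a < s (1 if there are none).
modLcm : ℕ → (ℕ → ℕ) → ℕ
modLcm zero    m = 1
modLcm (suc s) m = comb (modLcm s m) (m s)

modLcm≢0 : ∀ s m → modLcm s m ≢ 0
modLcm≢0 zero    m = λ ()
modLcm≢0 (suc s) m = comb≢0ˡ (modLcm s m) (m s) (modLcm≢0 s m)

∣₀-modLcm : ∀ {s m a} → a < s → m a ∣₀ + modLcm s m
∣₀-modLcm {suc s} {m} {a} a<1+s with ℕₚ.m<1+n⇒m<n∨m≡n a<1+s
... | inj₁ a<s  = λ ma≢0 → ℤ∣.∣-trans (∣₀-modLcm a<s ma≢0)
                    (comb-∣₀ˡ (modLcm s m) (m s) (λ _ → ℤ∣.∣-refl) (modLcm≢0 s m))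
... | inj₂ refl = comb-∣₀ʳ (modLcm s m) (m s) (λ _ → ℤ∣.∣-refl)

gcd-modLcm-∣ : ∀ {M N} s m → M ≢ 0 → (∀ a → a < s → m a ≢ 0 → gcd M (m a) ∣ℕ N) →
               gcd M (modLcm s m) ∣ℕ N
gcd-modLcm-∣ {M} {N} zero    m _   _ = subst (_∣ℕ N) (sym (gcd-zeroʳ M)) (ℕ∣.1∣ N)
gcd-modLcm-∣ (suc s) m M≢0 h =
  gcd-comb-∣ (modLcm s m) (m s) M≢0 (modLcm≢0 s m)
    (gcd-modLcm-∣ s m M≢0 λ a a<s → h a (ℕₚ.m<n⇒m<1+n a<s)) (h s (ℕₚ.n<1+n s))

Compatible : ℕ → (ℕ → ℕ) → (ℕ → ℤ) → Set
Compatible s m v = ∀ a b → a < s → b < s → m a ≢ 0 → m b ≢ 0 → + gcd (m a) (m b) ∣ v a - v b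

Solves : ℕ → (ℕ → ℕ) → (ℕ → ℤ) → ℤ → Set
Solves s m v x = ∀ a → a < s → m a ∣₀ v a - x

-- A solution x for the first s moduli may be corrected by any multiple L * t of their lcm L;
-- m s ∣ (v s - x) - L * t is solvable in t because gcd L (m s) ∣ v s - x by gcd-modLcm-∣.
crt : ∀ s m v → Compatible s m v → ∃ (Solves s m v)
crt zero    m v _      = 0ℤ , λ _ ()
crt (suc s) m v compat = x + + L * t , solves
  where
  L : ℕ
  L = modLcm s m
  IH : ∃ (Solves s m v)
  IH = crt s m v λ a b a<s b<s → compat a b (ℕₚ.m<n⇒m<1+n a<s) (ℕₚ.m<n⇒m<1+n b<s)
  x : ℤ
  x = proj₁ IH
  correction : ∃ λ t → m s ∣₀ (v s - x) - + L * t
  correction with m s ℕ.≟ 0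
  ... | yes ms≡0 = 0ℤ , λ ms≢0 → ⊥-elim (ms≢0 ms≡0)
  ... | no  ms≢0 = let t , ∣t = crt₂ L (m s) (v s - x) gcd∣ in t , λ _ → ∣t
    where
    via-a : ∀ a → a < s → m a ≢ 0 → gcd (m s) (m a) ∣ℕ ∣ v s - x ∣
    via-a a a<s ma≢0 = ℤ∣.∣⇒∣ᵤ (subst (_ ∣_) (split (v s) (v a) x)
      (ℤ∣.∣m∣n⇒∣m+n (compat s a (ℕₚ.n<1+n s) (ℕₚ.m<n⇒m<1+n a<s) ms≢0 ma≢0)
                    (ℤ∣.∣-trans (+∣+ (gcd[m,n]∣n (m s) (m a))) (proj₂ IH a a<s ma≢0))))
      where
      split : ∀ p q r → (p - q) + (q - r) ≡ p - r
      split = solve-∀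
    gcd∣ : gcd L (m s) ∣ℕ ∣ v s - x ∣
    gcd∣ = subst (_∣ℕ ∣ v s - x ∣) (gcd-comm (m s) L) (gcd-modLcm-∣ s m ms≢0 via-a)
  t : ℤ
  t = proj₁ correction
  reassoc : ∀ p y u → (p - y) - u ≡ p - (y + u)
  reassoc = solve-∀
  solves : Solves (suc s) m v (x + + L * t)
  solves a a<1+s with ℕₚ.m<1+n⇒m<n∨m≡n a<1+s
  ... | inj₁ a<s  = λ ma≢0 → subst (_ ∣_) (reassoc (v a) x (+ L * t))
          (ℤ∣.∣m∣n⇒∣m-n (proj₂ IH a a<s ma≢0) (ℤ∣.∣m⇒∣m*n t (∣₀-modLcm a<s ma≢0)))
  ... | inj₂ refl = λ ms≢0 → subst (_ ∣_) (reassoc (v s) x (+ L * t)) (proj₂ correction ms≢0)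


-- One step of the collapse sequence

≡ᵇ-refl : ∀ a → (a ≡ᵇ a) ≡ true
≡ᵇ-refl a = dec-true (a ℕ.≟ a) refl

≢⇒≡ᵇ-false : ∀ {a b} → a ≢ b → (a ≡ᵇ b) ≡ false
≢⇒≡ᵇ-false {a} {b} = dec-false (a ℕ.≟ b)

IsSymmetric : ℕ → Wt → Set
IsSymmetric k H = ∀ a b → a < k → b < k → H a b ≡ H b a

IsSplineℕ : ℕ → Wt → (ℕ → ℤ) → Set
IsSplineℕ k H f = ∀ a b → a < k → b < k → H a b ∣₀ f a - f b

update : ℕ → ℤ → (ℕ → ℤ) → ℕ → ℤ
update s x f a = if a ≡ᵇ s then x else f a

update-≡ : ∀ s x f → update s x f s ≡ x
update-≡ s x f = cong (if_then x else f s) (≡ᵇ-refl s)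

update-≢ : ∀ {s a} x f → a ≢ s → update s x f a ≡ f a
update-≢ {a = a} x f a≢s = cong (if_then x else f a) (≢⇒≡ᵇ-false a≢s)

update-∣₀ : ∀ {w s a} x f → a < s → w ∣₀ f a - x → w ∣₀ update s x f a - update s x f s
update-∣₀ {w} {s} x f a<s h =
  subst₂ (λ p q → w ∣₀ p - q) (sym (update-≢ x f (ℕₚ.<⇒≢ a<s))) (sym (update-≡ s x f)) h

update-spline : ∀ s H f x → IsSymmetric (suc s) H → IsSplineℕ s H f →
                (∀ a → a < s → H a s ∣₀ f a - x) → IsSplineℕ (suc s) H (update s x f)
update-spline s H f x sym-H sp to-s a b a<1+s b<1+s
  with ℕₚ.m<1+n⇒m<n∨m≡n a<1+s | ℕₚ.m<1+n⇒m<n∨m≡n b<1+s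
... | inj₁ a<s  | inj₁ b<s  = subst₂ (λ p q → H a b ∣₀ p - q)
        (sym (update-≢ x f (ℕₚ.<⇒≢ a<s))) (sym (update-≢ x f (ℕₚ.<⇒≢ b<s))) (sp a b a<s b<s)
... | inj₁ a<s  | inj₂ refl = update-∣₀ x f a<s (to-s a a<s)
... | inj₂ refl | inj₁ b<s  = subst (_∣₀ _) (sym-H b a b<1+s a<1+s)
                                (∣₀-swap (H b a) (update s x f b) (update s x f s)
                                  (update-∣₀ x f b<s (to-s b b<s)))
... | inj₂ refl | inj₂ refl = λ _ → ∣-x-x _ (update s x f s)

collapse-≢ : ∀ s H {a b} → a ≢ b → collapse s H a b ≡ comb (H a b) (newEdge (H a s) (H b s))
collapse-≢ s H {a} {b} a≢b =
  cong (if_then 0 else comb (H a b) (newEdge (H a s) (H b s))) (≢⇒≡ᵇ-false a≢b)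

collapse-symmetric : ∀ {k} s H → IsSymmetric k H → IsSymmetric k (collapse s H)
collapse-symmetric s H sym-H a b a<k b<k with a ℕ.≟ b
... | yes refl = refl
... | no  a≢b  = begin
  collapse s H a b                        ≡⟨ collapse-≢ s H a≢b ⟩
  comb (H a b) (newEdge (H a s) (H b s))  ≡⟨ cong₂ comb (sym-H a b a<k b<k) (newEdge-comm (H a s) (H b s)) ⟩
  comb (H b a) (newEdge (H b s) (H a s))  ≡⟨ collapse-≢ s H (a≢b ∘ sym) ⟨
  collapse s H b a                        ∎
  where open ≡-Reasoning

collapse-spline : ∀ s H f → IsSplineℕ (suc s) H f → IsSplineℕ s (collapse s H) f
collapse-spline s H f sp a b a<s b<s with a ℕ.≟ b
... | yes refl = λ _ → ∣-x-x _ (f a)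
... | no  a≢b  = subst (_∣₀ f a - f b) (sym (collapse-≢ s H a≢b))
  (comb-∣₀ (H a b) _ (sp a b (ℕₚ.m<n⇒m<1+n a<s) (ℕₚ.m<n⇒m<1+n b<s))
    (subst (newEdge (H a s) (H b s) ∣₀_) (cancel (f a) (f b) (f s))
      (newEdge-∣₀ (H a s) (H b s) (sp a s (ℕₚ.m<n⇒m<1+n a<s) (ℕₚ.n<1+n s))
                                  (sp b s (ℕₚ.m<n⇒m<1+n b<s) (ℕₚ.n<1+n s)))))
  where
  cancel : ∀ p q r → (p - r) - (q - r) ≡ p - q
  cancel = solve-∀

collapse-spline⁻ : ∀ s H f → IsSplineℕ s (collapse s H) f → IsSplineℕ s H f
collapse-spline⁻ s H f sp a b a<s b<s with a ℕ.≟ b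
... | yes refl = λ _ → ∣-x-x _ (f a)
... | no  a≢b  = comb-∣₀ˡ (H a b) _ (subst (_∣₀ f a - f b) (collapse-≢ s H a≢b) (sp a b a<s b<s))

collapse-compatible : ∀ s H f → IsSplineℕ s (collapse s H) f → Compatible s (λ a → H a s) f
collapse-compatible s H f sp a b a<s b<s Has≢0 Hbs≢0 with a ℕ.≟ b
... | yes refl = ∣-x-x _ (f a)
... | no  a≢b  = newEdge-∣₀⇒gcd-∣ (H a s) (H b s) Has≢0 Hbs≢0
  (comb-∣₀ʳ (H a b) _ (subst (_∣₀ f a - f b) (collapse-≢ s H a≢b) (sp a b a<s b<s)))

collapse-extend : ∀ s H f → IsSymmetric (suc s) H → IsSplineℕ s (collapse s H) f →
                  ∃ λ x → IsSplineℕ (suc s) H (update s x f)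
collapse-extend s H f sym-H sp =
  let x , solves = crt s (λ a → H a s) f (collapse-compatible s H f sp)
  in  x , update-spline s H f x sym-H (collapse-spline⁻ s H f sp) solves

∈-incidentWeights⁺ : ∀ H s {j} → j < s → H j s ≢ 0 → H j s ∈ incidentWeights H s
∈-incidentWeights⁺ H s j<s Hjs≢0 =
  ∈ₚ.∈-filter⁺ (λ x → ¬? (x ℕ.≟ 0)) (∈ₚ.∈-map⁺ (λ j → H j s) (∈ₚ.∈-upTo⁺ j<s)) Hjs≢0

∈-incidentWeights⁻ : ∀ H s {x} → x ∈ incidentWeights H s → ∃ λ j → j < s × x ≡ H j s × x ≢ 0
∈-incidentWeights⁻ H s x∈ with ∈ₚ.∈-filter⁻ (λ x → ¬? (x ℕ.≟ 0)) x∈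
... | x∈map , x≢0 with ∈ₚ.∈-map⁻ (λ j → H j s) x∈map
... | j , j∈ , refl = j , ∈ₚ.∈-upTo⁻ j∈ , refl , x≢0

incidentLcm : Wt → ℕ → ℕ
incidentLcm H s = lcmList (incidentWeights H s)

incidentLcm≢0 : ∀ H s → incidentLcm H s ≢ 0
incidentLcm≢0 H s =
  lcmList≢0 (incidentWeights H s) λ x∈ → proj₂ (proj₂ (proj₂ (∈-incidentWeights⁻ H s x∈)))

∣₀-incidentLcm : ∀ H {s a} → a < s → H a s ∣₀ + incidentLcm H s
∣₀-incidentLcm H {s} a<s Has≢0 =
  +∣+ (∈⇒∣lcmList (incidentWeights H s) (∈-incidentWeights⁺ H s a<s Has≢0))

incidentLcm-∣ : ∀ H s {z} → (∀ a → a < s → H a s ∣₀ z) → + incidentLcm H s ∣ z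
incidentLcm-∣ H s {z} h =
  ℤ∣.∣ᵤ⇒∣ (lcmList-least (incidentWeights H s) λ x∈ → weight-∣ (∈-incidentWeights⁻ H s x∈))
  where
  weight-∣ : ∀ {x} → ∃ (λ j → j < s × x ≡ H j s × x ≢ 0) → x ∣ℕ ∣ z ∣
  weight-∣ (j , j<s , refl , x≢0) = ℤ∣.∣⇒∣ᵤ (h j j<s x≢0)

kernel-∣ : ∀ s H f → IsSplineℕ (suc s) H f → (∀ a → a < s → f a ≡ 0ℤ) → + incidentLcm H s ∣ f s
kernel-∣ s H f sp vanishes = incidentLcm-∣ H s λ a a<s →
  subst (H a s ∣₀_) (ℤₚ.+-identityʳ (f s))
    (subst (λ p → H a s ∣₀ f s - p) (vanishes a a<s)
      (∣₀-swap (H a s) (f a) (f s) (sp a s (ℕₚ.m<n⇒m<1+n a<s) (ℕₚ.n<1+n s))))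

-- mvec n W i is definitionally kernelGenerator (G n W i) (toℕ i) ∘ toℕ.
kernelGenerator : Wt → ℕ → ℕ → ℤ
kernelGenerator H s = update s (+ incidentLcm H s) (λ _ → 0ℤ)

kernelGenerator-spline : ∀ s H → IsSymmetric (suc s) H → IsSplineℕ (suc s) H (kernelGenerator H s)
kernelGenerator-spline s H sym-H = update-spline s H _ _ sym-H (λ _ _ _ _ _ → ∣-x-x _ 0ℤ)
  λ a a<s → subst (H a s ∣₀_) (sym (ℤₚ.+-identityˡ _)) (λ ne → ℤ∣.∣m⇒∣-m (∣₀-incidentLcm H a<s ne))

kernel-generated : ∀ s H f → IsSplineℕ (suc s) H f → (∀ a → a < s → f a ≡ 0ℤ) →
                   ∃ λ q → ∀ a → a < suc s → f a ≡ q * kernelGenerator H s a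
kernel-generated s H f sp vanishes with kernel-∣ s H f sp vanishes
... | divides q fs≡qL = q , multiple
  where
  multiple : ∀ a → a < suc s → f a ≡ q * kernelGenerator H s a
  multiple a a<1+s with ℕₚ.m<1+n⇒m<n∨m≡n a<1+s
  ... | inj₁ a<s  = trans (vanishes a a<s)
          (sym (trans (cong (q *_) (update-≢ _ _ (ℕₚ.<⇒≢ a<s))) (ℤₚ.*-zeroʳ q)))
  ... | inj₂ refl = trans fs≡qL (cong (q *_) (sym (update-≡ s _ _)))


-- The complete collapse sequence

IsSymmetric-≤ : ∀ {j k H} → j ≤ k → IsSymmetric k H → IsSymmetric j H
IsSymmetric-≤ j≤k sym-H a b a<j b<j = sym-H a b (ℕₚ.<-≤-trans a<j j≤k) (ℕₚ.<-≤-trans b<j j≤k)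

lev-symmetric : ∀ {n W} → IsSymmetric n W → ∀ d → IsSymmetric n (lev n W d)
lev-symmetric sym-W zero    = sym-W
lev-symmetric {n} {W} sym-W (suc d) = collapse-symmetric (n ∸ suc d) (lev n W d) (lev-symmetric sym-W d)

n∸d≡1+n∸1+d : ∀ {n d} → d < n → n ∸ d ≡ suc (n ∸ suc d)
n∸d≡1+n∸1+d {suc n} {zero}  _         = refl
n∸d≡1+n∸1+d {suc n} {suc d} (s≤s d<n) = n∸d≡1+n∸1+d d<n

lev-spline : ∀ {n W f} d → d ≤ n → IsSplineℕ n W f → IsSplineℕ (n ∸ d) (lev n W d) f
lev-spline zero _ sp = sp
lev-spline {n} {W} {f} (suc d) d<n sp = collapse-spline (n ∸ suc d) (lev n W d) f
  (subst (λ k → IsSplineℕ k (lev n W d) f) (n∸d≡1+n∸1+d d<n) (lev-spline {f = f} d (ℕₚ.<⇒≤ d<n) sp))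

lev-extend : ∀ {n W} → IsSymmetric n W → ∀ d → d ≤ n → ∀ h → IsSplineℕ (n ∸ d) (lev n W d) h →
             ∃ λ g → IsSplineℕ n W g × (∀ a → a < n ∸ d → g a ≡ h a)
lev-extend sym-W zero _ h sp = h , sp , λ _ _ → refl
lev-extend {n} {W} sym-W (suc d) d<n h sp =
  let x , extended         = collapse-extend s (lev n W d) h sym-lev sp
      g , g-spline , agree = lev-extend sym-W d (ℕₚ.<⇒≤ d<n) (update s x h)
                               (subst (λ k → IsSplineℕ k (lev n W d) (update s x h)) (sym n∸d≡1+s) extended)
  in  g , g-spline , λ a a<s → trans (agree a (a<s⇒a<n∸d a<s)) (update-≢ x h (ℕₚ.<⇒≢ a<s))
  where
  s : ℕ
  s = n ∸ suc d
  n∸d≡1+s : n ∸ d ≡ suc s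
  n∸d≡1+s = n∸d≡1+n∸1+d d<n
  a<s⇒a<n∸d : ∀ {a} → a < s → a < n ∸ d
  a<s⇒a<n∸d {a} a<s = subst (a <_) (sym n∸d≡1+s) (ℕₚ.m<n⇒m<1+n a<s)
  sym-lev : IsSymmetric (suc s) (lev n W d)
  sym-lev = IsSymmetric-≤ (subst (_≤ n) n∸d≡1+s (ℕₚ.m∸n≤m n d)) (lev-symmetric sym-W d)


atℕ : ∀ {k} → Vect k → ℕ → ℤ
atℕ {zero}  g _       = 0ℤ
atℕ {suc k} g zero    = g zero
atℕ {suc k} g (suc a) = atℕ (g ∘ suc) a

atℕ-toℕ : ∀ {k} (g : Vect k) i → atℕ g (toℕ i) ≡ g i
atℕ-toℕ g zero    = refl
atℕ-toℕ g (suc i) = atℕ-toℕ (g ∘ suc) i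

atℕ-vanishes : ∀ {k i} (g : Vect k) → (∀ a → toℕ a < i → g a ≡ 0ℤ) → ∀ a → a < i → atℕ g a ≡ 0ℤ
atℕ-vanishes {zero}          g _ _       _         = refl
atℕ-vanishes {suc k}         g h zero    0<i       = h zero 0<i
atℕ-vanishes {suc k} {suc i} g h (suc a) (s≤s a<i) =
  atℕ-vanishes (g ∘ suc) (λ b b<i → h (suc b) (s≤s b<i)) a a<i

spline-edge : ∀ {k H} (g : Vect k) → IsSpline k H g → ∀ a b → H (toℕ a) (toℕ b) ∣₀ g a - g b
spline-edge g sp a b ne = ℤ∣.∣ᵤ⇒∣ {i = g a - g b} (sp a b ne)

edges⇒spline : ∀ {k H} (g : Vect k) → (∀ a b → H (toℕ a) (toℕ b) ∣₀ g a - g b) → IsSpline k H g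
edges⇒spline g h a b ne = ℤ∣.∣⇒∣ᵤ (h a b ne)

IsSpline⇒IsSplineℕ : ∀ {k H} (g : Vect k) → IsSpline k H g → IsSplineℕ k H (atℕ g)
IsSpline⇒IsSplineℕ {k} {H} g sp a b a<k b<k = subst₂ (λ a b → H a b ∣₀ atℕ g a - atℕ g b)
  (Fₚ.toℕ-fromℕ< a<k) (Fₚ.toℕ-fromℕ< b<k) (at-Fin (fromℕ< a<k) (fromℕ< b<k))
  where
  at-Fin : ∀ i j → H (toℕ i) (toℕ j) ∣₀ atℕ g (toℕ i) - atℕ g (toℕ j)
  at-Fin i j = subst₂ (λ p q → H (toℕ i) (toℕ j) ∣₀ p - q) (sym (atℕ-toℕ g i)) (sym (atℕ-toℕ g j))
                 (spline-edge {H = H} g sp i j)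

IsSplineℕ⇒IsSpline : ∀ {k H} (f : ℕ → ℤ) → IsSplineℕ k H f → IsSpline k H (f ∘ toℕ)
IsSplineℕ⇒IsSpline {H = H} f sp =
  edges⇒spline {H = H} (f ∘ toℕ) λ i j → sp (toℕ i) (toℕ j) (Fₚ.toℕ<n i) (Fₚ.toℕ<n j)

spline-⊕ : ∀ {k H} (g h : Vect k) → IsSpline k H g → IsSpline k H h → IsSpline k H (g ⊕ h)
spline-⊕ {H = H} g h sg sh = edges⇒spline {H = H} (g ⊕ h) λ a b ne →
  subst (_ ∣_) (interchange (g a) (h a) (g b) (h b)) (ℤ∣.∣m∣n⇒∣m+n (spline-edge {H = H} g sg a b ne) (spline-edge {H = H} h sh a b ne))
  where
  interchange : ∀ x y u v → (x - u) + (y - v) ≡ (x + y) - (u + v)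
  interchange = solve-∀

spline-· : ∀ {k H} c (g : Vect k) → IsSpline k H g → IsSpline k H (c · g)
spline-· {H = H} c g sg = edges⇒spline {H = H} (c · g) λ a b ne → subst (_ ∣_) (distrib c (g a) (g b))
  (ℤ∣.∣n⇒∣m*n c (spline-edge {H = H} g sg a b ne))
  where
  distrib : ∀ c x y → c * (x - y) ≡ c * x - c * y
  distrib = solve-∀

spline? : ∀ k H (g : Vect k) → Dec (IsSpline k H g)
spline? k H g = Fₚ.all? λ a → Fₚ.all? λ b →
  ¬? (H (toℕ a) (toℕ b) ℕ.≟ 0) →-dec (H (toℕ a) (toℕ b) ℕ∣.∣? ∣ g a - g b ∣)

sumFin≡sum : ∀ {m} (f : Fin m → ℤ) → sumFin f ≡ sum f
sumFin≡sum {zero}  f = refl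
sumFin≡sum {suc m} f = cong (_+_ (f zero)) (sumFin≡sum (f ∘ suc))

sumFin-cong : ∀ {m} {f g : Fin m → ℤ} → (∀ k → f k ≡ g k) → sumFin f ≡ sumFin g
sumFin-cong {f = f} {g} f≗g = trans (sumFin≡sum f) (trans (sum-cong-≗ f≗g) (sym (sumFin≡sum g)))

sumFin-+ : ∀ {m} (f g : Fin m → ℤ) → sumFin (λ k → f k + g k) ≡ sumFin f + sumFin g
sumFin-+ f g = trans (sumFin≡sum (λ k → f k + g k))
  (trans (∑-distrib-+ f g) (sym (cong₂ _+_ (sumFin≡sum f) (sumFin≡sum g))))

sumFin-* : ∀ {m} t (f : Fin m → ℤ) → sumFin (λ k → t * f k) ≡ t * sumFin f
sumFin-* t f = trans (sumFin≡sum (λ k → t * f k))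
  (trans (sym (*-distribˡ-sum t f)) (cong (t *_) (sym (sumFin≡sum f))))

sumFin-sub : ∀ {m} (f g : Fin m → ℤ) → sumFin (λ k → f k - g k) ≡ sumFin f - sumFin g
sumFin-sub f g = begin
  sumFin (λ k → f k - g k)                   ≡⟨ sumFin-cong (λ k → as-sum (f k) (g k)) ⟩
  sumFin (λ k → f k + -1ℤ * g k)             ≡⟨ sumFin-+ f (λ k → -1ℤ * g k) ⟩
  sumFin f + sumFin (λ k → -1ℤ * g k)        ≡⟨ cong (_+_ (sumFin f)) (sumFin-* -1ℤ g) ⟩
  sumFin f + -1ℤ * sumFin g                  ≡⟨ as-sum (sumFin f) (sumFin g) ⟨
  sumFin f - sumFin g                        ∎
  where
  open ≡-Reasoning
  as-sum : ∀ x y → x - y ≡ x + -1ℤ * y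
  as-sum = solve-∀

sumFin-single : ∀ {m} (f : Fin m → ℤ) j → (∀ k → k ≢ j → f k ≡ 0ℤ) → sumFin f ≡ f j
sumFin-single {suc m} f j others-zero = begin
  sumFin f                               ≡⟨ sumFin≡sum f ⟩
  sum f                                  ≡⟨ sum-remove {i = j} f ⟩
  f j + sum {m} (λ k → f (punchIn j k))  ≡⟨ cong (_+_ (f j)) (sum-cong-≗ {m} others) ⟩
  f j + sum {m} (λ _ → 0ℤ)               ≡⟨ cong (_+_ (f j)) (sum-replicate-zero m) ⟩
  f j + 0ℤ                               ≡⟨ ℤₚ.+-identityʳ (f j) ⟩
  f j                                    ∎
  where
  open ≡-Reasoning
  others : ∀ k → f (punchIn j k) ≡ 0ℤ
  others k = others-zero (punchIn j k) (punchInᵢ≢i j k)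

sumFin-∣ : ∀ {m} d (f : Fin m → ℤ) → (∀ k → d ∣ f k) → d ∣ sumFin f
sumFin-∣ {zero}  d f _ = divides 0ℤ (sym (ℤₚ.*-zeroˡ d))
sumFin-∣ {suc m} d f h = ℤ∣.∣m∣n⇒∣m+n (h zero) (sumFin-∣ d (f ∘ suc) (h ∘ suc))

indicator : ∀ {n} → Fin n → Fin n → ℤ
indicator j k = if does (k Fin.≟ j) then 1ℤ else 0ℤ

module _ {n : ℕ} (B : Fin n → Vect n) where

  lincomb-+ : ∀ c d a → lincomb (λ j → c j + d j) B a ≡ lincomb c B a + lincomb d B a
  lincomb-+ c d a = trans (sumFin-cong λ j → ℤₚ.*-distribʳ-+ (B j a) (c j) (d j))
                          (sumFin-+ (λ j → c j * B j a) (λ j → d j * B j a))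

  lincomb-* : ∀ t c a → lincomb (λ j → t * c j) B a ≡ t * lincomb c B a
  lincomb-* t c a = trans (sumFin-cong λ j → ℤₚ.*-assoc t (c j) (B j a)) (sumFin-* t (λ j → c j * B j a))

  lincomb-sub : ∀ c d a → lincomb (λ j → c j - d j) B a ≡ lincomb c B a - lincomb d B a
  lincomb-sub c d a = trans (sumFin-cong λ j → distrib (c j) (d j) (B j a))
                          (sumFin-sub (λ j → c j * B j a) (λ j → d j * B j a))
    where
    distrib : ∀ x y z → (x - y) * z ≡ x * z - y * z
    distrib = solve-∀

  lincomb-spline : ∀ {W} → (∀ j → IsSpline n W (B j)) → ∀ c → IsSpline n W (lincomb c B)
  lincomb-spline {W} B-spline c = edges⇒spline {H = W} (lincomb c B) λ a b ne →
    subst (_ ∣_) (lincomb-edge a b)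
      (sumFin-∣ _ _ λ j → ℤ∣.∣n⇒∣m*n (c j) (spline-edge {H = W} (B j) (B-spline j) a b ne))
    where
    distrib : ∀ x y z → x * (y - z) ≡ x * y - x * z
    distrib = solve-∀
    lincomb-edge : ∀ a b → sumFin (λ j → c j * (B j a - B j b)) ≡ lincomb c B a - lincomb c B b
    lincomb-edge a b = trans (sumFin-cong λ j → distrib (c j) (B j a) (B j b))
                             (sumFin-sub (λ j → c j * B j a) (λ j → c j * B j b))

  lincomb-zero : ∀ a → lincomb (λ _ → 0ℤ) B a ≡ 0ℤ
  lincomb-zero a = trans (sumFin-cong λ j → ℤₚ.*-zeroˡ (B j a))
                         (trans (sumFin≡sum {n} (λ _ → 0ℤ)) (sum-replicate-zero n))

  lincomb-indicator : ∀ j a → lincomb (indicator j) B a ≡ B j a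
  lincomb-indicator j a = begin
    lincomb (indicator j) B a  ≡⟨ sumFin-single (λ k → indicator j k * B k a) j others ⟩
    indicator j j * B j a      ≡⟨ cong (λ e → (if e then 1ℤ else 0ℤ) * B j a) (dec-true (j Fin.≟ j) refl) ⟩
    1ℤ * B j a                 ≡⟨ ℤₚ.*-identityˡ (B j a) ⟩
    B j a                      ∎
    where
    open ≡-Reasoning
    others : ∀ k → k ≢ j → indicator j k * B k a ≡ 0ℤ
    others k k≢j = trans (cong (λ e → (if e then 1ℤ else 0ℤ) * B k a) (dec-false (k Fin.≟ j) k≢j))
                         (ℤₚ.*-zeroˡ (B k a))

  lincomb-injective : (∀ c → lincomb c B ≋ (λ _ → 0ℤ) → ∀ j → c j ≡ 0ℤ) →
                      ∀ c d → lincomb c B ≋ lincomb d B → ∀ j → c j ≡ d j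
  lincomb-injective independent c d c≋d j = ℤₚ.i-j≡0⇒i≡j (c j) (d j)
    (independent (λ k → c k - d k) (λ a → trans (lincomb-sub c d a) (ℤₚ.i≡j⇒i-j≡0 (c≋d a))) j)


-- Triangular families of splines

module Triangular {n : ℕ} {W : Wt} (M : Fin n → Vect n) (L : Fin n → ℕ)
  (M-spline : ∀ i → IsSpline n W (M i))
  (M-below  : ∀ i a → toℕ a < toℕ i → M i a ≡ 0ℤ)
  (M-diag   : ∀ i → M i i ≡ + L i)
  (L≢0      : ∀ i → L i ≢ 0)
  (L-∣      : ∀ i g → IsSpline n W g → (∀ a → toℕ a < toℕ i → g a ≡ 0ℤ) → + L i ∣ g i)
  where

  +L≢0 : ∀ i → + L i ≢ 0ℤ
  +L≢0 i = L≢0 i ∘ cong ∣_∣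

  M∈F : ∀ i → InF n W i (M i)
  M∈F i = M-spline i , M-below i , λ Mii≡0 → +L≢0 i (trans (sym (M-diag i)) Mii≡0)

  M-minimal : ∀ i → Minimal n W i (M i)
  M-minimal i = M∈F i , subst (+ 0 ℤ.<_) (sym (M-diag i)) (ℤ.+<+ (ℕₚ.n≢0⇒n>0 (L≢0 i))) , least
    where
    least : ∀ F → InF n W i F → M i i ℤ.≤ + ∣ F i ∣
    least F (F-spline , F-below , Fi≢0) = subst (ℤ._≤ + ∣ F i ∣) (sym (M-diag i))
      (ℤ.+≤+ (ℕ∣.∣⇒≤ {{ℕ.≢-nonZero (Fi≢0 ∘ ℤₚ.∣i∣≡0⇒i≡0)}} (ℤ∣.∣⇒∣ᵤ (L-∣ i F F-spline F-below))))

  -- At coordinate j the terms k < j vanish by induction and the terms k > j by triangularity.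
  independent : ∀ c → lincomb c M ≋ (λ _ → 0ℤ) → ∀ j → c j ≡ 0ℤ
  independent c c≋0 = All.wfRec <-wellFounded 0ℓ (λ j → c j ≡ 0ℤ) step
    where
    step : ∀ j → (∀ {k} → k Fin.< j → c k ≡ 0ℤ) → c j ≡ 0ℤ
    step j earlier-zero = ℤₚ.*-cancelʳ-≡ (c j) 0ℤ (+ L j) {{ℤ.≢-nonZero (+L≢0 j)}} (begin
      c j * + L j     ≡⟨ cong (c j *_) (M-diag j) ⟨
      c j * M j j     ≡⟨ sumFin-single (λ k → c k * M k j) j off-diagonal ⟨
      lincomb c M j   ≡⟨ c≋0 j ⟩
      0ℤ              ∎)
      where
      open ≡-Reasoning
      off-diagonal : ∀ k → k ≢ j → c k * M k j ≡ 0ℤ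
      off-diagonal k k≢j with Fₚ.<-cmp k j
      ... | tri< k<j _ _ = trans (cong (_* M k j) (earlier-zero k<j)) (ℤₚ.*-zeroˡ (M k j))
      ... | tri≈ _ k≡j _ = ⊥-elim (k≢j k≡j)
      ... | tri> _ _ j<k = trans (cong (c k *_) (M-below k j j<k)) (ℤₚ.*-zeroʳ (c k))

  clear-leading : ∀ j g → IsSpline n W g → (∀ a → toℕ a < toℕ j → g a ≡ 0ℤ) →
                  ∃ λ t → ∀ a → toℕ a < suc (toℕ j) → (g ⊕ ((- t) · M j)) a ≡ 0ℤ
  clear-leading j g g-spline g-below with L-∣ j g g-spline g-below
  ... | divides t gj≡tL = t , cleared
    where
    cleared : ∀ a → toℕ a < suc (toℕ j) → g a + - t * M j a ≡ 0ℤ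
    cleared a a≤j with ℕₚ.m<1+n⇒m<n∨m≡n a≤j
    ... | inj₁ a<j = trans (cong₂ (λ x y → x + - t * y) (g-below a a<j) (M-below j a a<j))
                           (trans (ℤₚ.+-identityˡ (- t * 0ℤ)) (ℤₚ.*-zeroʳ (- t)))
    ... | inj₂ a≡j rewrite Fₚ.toℕ-injective a≡j =
      trans (cong₂ (λ x y → x + - t * y) gj≡tL (M-diag j)) (cancel t (+ L j))
      where
      cancel : ∀ t l → t * l + - t * l ≡ 0ℤ
      cancel = solve-∀

  spanning-below : ∀ k → k ≤ n → ∀ g → IsSpline n W g → (∀ a → toℕ a < n ∸ k → g a ≡ 0ℤ) →
                   ∃ λ c → g ≋ lincomb c M
  spanning-below zero _ g _ g-below =
    (λ _ → 0ℤ) , λ a → trans (g-below a (Fₚ.toℕ<n a)) (sym (lincomb-zero M a))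
  spanning-below (suc k) k<n g g-spline g-below = c , g≋lincomb-c
    where
    n∸k≡1+n∸1+k : n ∸ k ≡ suc (n ∸ suc k)
    n∸k≡1+n∸1+k = n∸d≡1+n∸1+d k<n
    j : Fin n
    j = fromℕ< (subst (_≤ n) n∸k≡1+n∸1+k (ℕₚ.m∸n≤m n k))
    toℕ-j : toℕ j ≡ n ∸ suc k
    toℕ-j = Fₚ.toℕ-fromℕ< _
    cleared : ∃ λ t → ∀ a → toℕ a < suc (toℕ j) → (g ⊕ ((- t) · M j)) a ≡ 0ℤ
    cleared = clear-leading j g g-spline (λ a a<j → g-below a (subst (toℕ a <_) toℕ-j a<j))
    t : ℤ
    t = proj₁ cleared
    g′ : Vect n
    g′ = g ⊕ ((- t) · M j)
    g′-spline : IsSpline n W g′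
    g′-spline = spline-⊕ {H = W} g ((- t) · M j) g-spline (spline-· {H = W} (- t) (M j) (M-spline j))
    IH : ∃ λ c′ → g′ ≋ lincomb c′ M
    IH = spanning-below k (ℕₚ.<⇒≤ k<n) g′ g′-spline
           λ a a<n∸k → proj₂ cleared a (subst (toℕ a <_) (trans n∸k≡1+n∸1+k (cong suc (sym toℕ-j))) a<n∸k)
    c′ : Fin n → ℤ
    c′ = proj₁ IH
    c : Fin n → ℤ
    c i = c′ i + t * indicator j i
    restore : ∀ x t m → x ≡ (x + - t * m) + t * m
    restore = solve-∀
    g≋lincomb-c : g ≋ lincomb c M
    g≋lincomb-c a = begin
      g a
        ≡⟨ restore (g a) t (M j a) ⟩
      g′ a + t * M j a
        ≡⟨ cong₂ _+_ (proj₂ IH a) (cong (t *_) (sym (lincomb-indicator M j a))) ⟩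
      lincomb c′ M a + t * lincomb (indicator j) M a
        ≡⟨ cong (_+_ (lincomb c′ M a)) (lincomb-* M t (indicator j) a) ⟨
      lincomb c′ M a + lincomb (λ i → t * indicator j i) M a
        ≡⟨ lincomb-+ M c′ (λ i → t * indicator j i) a ⟨
      lincomb c M a
        ∎
      where open ≡-Reasoning

  spanning : ∀ g → IsSpline n W g → ∃ λ c → g ≋ lincomb c M
  spanning g g-spline = spanning-below n ℕₚ.≤-refl g g-spline λ a a<n∸n →
    ⊥-elim (ℕₚ.n≮0 (subst (toℕ a <_) (ℕₚ.n∸n≡0 n) a<n∸n))

  flowUpBasis : IsFlowUpBasis n W M
  flowUpBasis = (M-spline , independent , spanning) , M-minimal


-- Coordinates in a basis and the decomposition into kernels

·-cancel : ∀ {k} (m : Vect k) a → m a ≢ 0ℤ → ∀ c d → (c · m) ≋ (d · m) → c ≡ d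
·-cancel m a ma≢0 c d c·m≋d·m = ℤₚ.*-cancelʳ-≡ c d (m a) {{ℤ.≢-nonZero ma≢0}} (c·m≋d·m a)

InK-· : ∀ {n W i} c {g} → InK n W i g → InK n W i (c · g)
InK-· {n} {W} {i} c {g} (g-spline , g-below) =
  spline-· {H = G n W i} c g g-spline , λ a a<i → trans (cong (c *_) (g-below a a<i)) (ℤₚ.*-zeroʳ c)

module Coordinates {n : ℕ} {W : Wt} (B : Fin n → Vect n) (basis : IsZBasis n W B) where

  independent : ∀ c → lincomb c B ≋ (λ _ → 0ℤ) → ∀ j → c j ≡ 0ℤ
  independent = proj₁ (proj₂ basis)

  spanning : ∀ g → IsSpline n W g → ∃ λ c → g ≋ lincomb c B
  spanning = proj₂ (proj₂ basis)

  -- Off the splines the coordinates are a junk value; IsoToSum only constrains Φ on splines.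
  coordinates : Vect n → Fin n → ℤ
  coordinates g with spline? n W g
  ... | yes g-spline = proj₁ (spanning g g-spline)
  ... | no  _        = λ _ → 0ℤ

  coordinates-spec : ∀ g → IsSpline n W g → g ≋ lincomb (coordinates g) B
  coordinates-spec g g-spline with spline? n W g
  ... | yes g-spline′ = proj₂ (spanning g g-spline′)
  ... | no  ¬spline   = ⊥-elim (¬spline g-spline)

  coordinates-unique : ∀ g c → IsSpline n W g → g ≋ lincomb c B → ∀ j → coordinates g j ≡ c j
  coordinates-unique g c g-spline g≋c = lincomb-injective B independent (coordinates g) c
    λ a → trans (sym (coordinates-spec g g-spline a)) (g≋c a)

  isoToSum : (m : SumVect n) → (∀ i → Generates (InK n W i) (m i)) → (∀ i → ∃ λ a → m i a ≢ 0ℤ) →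
             IsoToSum n W
  isoToSum m generates nonzero = Φ , Φ-∈K , Φ-cong , Φ-+ , Φ-· , Φ-injective , Φ-surjective
    where
    Φ : Vect n → SumVect n
    Φ g i = coordinates g i · m i

    Φ-of : ∀ g c → IsSpline n W g → g ≋ lincomb c B → Φ g ≋Σ (λ i → c i · m i)
    Φ-of g c g-spline g≋c i a = cong (_* m i a) (coordinates-unique g c g-spline g≋c i)

    Φ-∈K : ∀ g → IsSpline n W g → ∀ i → InK n W i (Φ g i)
    Φ-∈K g _ i = InK-· (coordinates g i) (proj₁ (generates i))

    Φ-cong : ∀ g h → IsSpline n W g → IsSpline n W h → g ≋ h → Φ g ≋Σ Φ h
    Φ-cong g h g-spline h-spline g≋h i a = sym (Φ-of h (coordinates g) h-spline
      (λ b → trans (sym (g≋h b)) (coordinates-spec g g-spline b)) i a)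

    Φ-+ : ∀ g h → IsSpline n W g → IsSpline n W h → Φ (g ⊕ h) ≋Σ (λ i → Φ g i ⊕ Φ h i)
    Φ-+ g h g-spline h-spline i a =
      trans (Φ-of (g ⊕ h) (λ j → coordinates g j + coordinates h j)
                  (spline-⊕ {H = W} g h g-spline h-spline) sum-spec i a)
            (ℤₚ.*-distribʳ-+ (m i a) (coordinates g i) (coordinates h i))
      where
      sum-spec : (g ⊕ h) ≋ lincomb (λ j → coordinates g j + coordinates h j) B
      sum-spec b = trans (cong₂ _+_ (coordinates-spec g g-spline b) (coordinates-spec h h-spline b))
                         (sym (lincomb-+ B (coordinates g) (coordinates h) b))

    Φ-· : ∀ c g → IsSpline n W g → Φ (c · g) ≋Σ (λ i → c · Φ g i)
    Φ-· c g g-spline i a =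
      trans (Φ-of (c · g) (λ j → c * coordinates g j) (spline-· {H = W} c g g-spline) scaled-spec i a)
            (ℤₚ.*-assoc c (coordinates g i) (m i a))
      where
      scaled-spec : (c · g) ≋ lincomb (λ j → c * coordinates g j) B
      scaled-spec b = trans (cong (c *_) (coordinates-spec g g-spline b)) (sym (lincomb-* B c (coordinates g) b))

    Φ-injective : ∀ g h → IsSpline n W g → IsSpline n W h → Φ g ≋Σ Φ h → g ≋ h
    Φ-injective g h g-spline h-spline Φg≋Φh a = begin
      g a                            ≡⟨ coordinates-spec g g-spline a ⟩
      lincomb (coordinates g) B a    ≡⟨ sumFin-cong (λ j → cong (_* B j a) (same-coordinates j)) ⟩
      lincomb (coordinates h) B a    ≡⟨ coordinates-spec h h-spline a ⟨
      h a                            ∎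
      where
      open ≡-Reasoning
      same-coordinates : ∀ j → coordinates g j ≡ coordinates h j
      same-coordinates j = let a , mja≢0 = nonzero j in
        ·-cancel (m j) a mja≢0 (coordinates g j) (coordinates h j) (Φg≋Φh j)

    Φ-surjective : ∀ y → (∀ i → InK n W i (y i)) → ∃ λ g → IsSpline n W g × Φ g ≋Σ y
    Φ-surjective y y∈K = g , g-spline , λ i a →
      trans (Φ-of g c g-spline (λ _ → refl) i a) (sym (proj₂ (y-gen i) a))
      where
      y-gen : ∀ i → ∃ λ c → y i ≋ (c · m i)
      y-gen i = proj₂ (generates i) (y i) (y∈K i)
      c : Fin n → ℤ
      c i = proj₁ (y-gen i)
      g : Vect n
      g = lincomb c B
      g-spline : IsSpline n W g
      g-spline = lincomb-spline B {W} (proj₁ basis) c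


-- The kernels K_i of the collapse sequence

module CollapseSequence {n : ℕ} {W : Wt} (sym-W : IsSymmetric n W) where

  n∸[n∸1+i]≡1+i : ∀ (i : Fin n) → n ∸ (n ∸ suc (toℕ i)) ≡ suc (toℕ i)
  n∸[n∸1+i]≡1+i i = ℕₚ.m∸[m∸n]≡n (Fₚ.toℕ<n i)

  G-spline : ∀ {f} → IsSplineℕ n W f → ∀ i → IsSplineℕ (suc (toℕ i)) (G n W i) f
  G-spline {f} sp i = subst (λ k → IsSplineℕ k (G n W i) f) (n∸[n∸1+i]≡1+i i)
    (lev-spline {n} {W} {f} (n ∸ suc (toℕ i)) (ℕₚ.m∸n≤m n (suc (toℕ i))) sp)

  G-symmetric : ∀ i → IsSymmetric (suc (toℕ i)) (G n W i)
  G-symmetric i = IsSymmetric-≤ (Fₚ.toℕ<n i) (lev-symmetric sym-W (n ∸ suc (toℕ i)))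

  G-extend : ∀ i h → IsSplineℕ (suc (toℕ i)) (G n W i) h →
             ∃ λ g → IsSplineℕ n W g × (∀ a → a < suc (toℕ i) → g a ≡ h a)
  G-extend i h sp with lev-extend sym-W (n ∸ suc (toℕ i)) (ℕₚ.m∸n≤m n (suc (toℕ i))) h
                         (subst (λ k → IsSplineℕ k (G n W i) h) (sym (n∸[n∸1+i]≡1+i i)) sp)
  ... | g , g-spline , agree =
    g , g-spline , λ a a≤i → agree a (subst (a <_) (sym (n∸[n∸1+i]≡1+i i)) a≤i)

  leading : Fin n → ℕ
  leading i = incidentLcm (G n W i) (toℕ i)

  mvec∈K : ∀ i → InK n W i (mvec n W i)
  mvec∈K i = IsSplineℕ⇒IsSpline (kernelGenerator (G n W i) (toℕ i))
               (kernelGenerator-spline (toℕ i) (G n W i) (G-symmetric i))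
           , λ a a<i → update-≢ _ _ (ℕₚ.<⇒≢ a<i)

  mvec-last≢0 : ∀ i → mvec n W i (fromℕ (toℕ i)) ≢ 0ℤ
  mvec-last≢0 i eq = incidentLcm≢0 (G n W i) (toℕ i) (cong ∣_∣ (begin
    + leading i                                             ≡⟨ update-≡ (toℕ i) _ _ ⟨
    kernelGenerator (G n W i) (toℕ i) (toℕ i)               ≡⟨ cong (kernelGenerator (G n W i) (toℕ i)) (Fₚ.toℕ-fromℕ (toℕ i)) ⟨
    mvec n W i (fromℕ (toℕ i))                              ≡⟨ eq ⟩
    0ℤ                                                      ∎))
    where open ≡-Reasoning

  K-generated : ∀ i g → InK n W i g → ∃ λ c → g ≋ (c · mvec n W i)
  K-generated i g (g-spline , g-below) =
    let q , multiple = kernel-generated (toℕ i) (G n W i) (atℕ g)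
                         (IsSpline⇒IsSplineℕ g g-spline) (atℕ-vanishes g g-below)
    in  q , λ a → trans (sym (atℕ-toℕ g a)) (multiple (toℕ a) (Fₚ.toℕ<n a))

  generates : ∀ i → Generates (InK n W i) (mvec n W i)
  generates i = mvec∈K i , K-generated i

  rank1 : ∀ i → Rank1 (InK n W i)
  rank1 i = (_· mvec n W i)
          , (λ c → InK-· c (mvec∈K i))
          , (λ c d a → ℤₚ.*-distribʳ-+ (mvec n W i a) c d)
          , (λ c d a → ℤₚ.*-assoc c d (mvec n W i a))
          , ·-cancel (mvec n W i) (fromℕ (toℕ i)) (mvec-last≢0 i)
          , λ g g∈K → let c , g≋ = K-generated i g g∈K in c , λ a → sym (g≋ a)

  spline-leading-∣ : ∀ i g → IsSpline n W g → (∀ a → toℕ a < toℕ i → g a ≡ 0ℤ) → + leading i ∣ g i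
  spline-leading-∣ i g g-spline g-below = subst (_ ∣_) (atℕ-toℕ g i)
    (kernel-∣ (toℕ i) (G n W i) (atℕ g) (G-spline {atℕ g} (IsSpline⇒IsSplineℕ {H = W} g g-spline) i)
              (atℕ-vanishes g g-below))

  restriction-entries : ∀ i (g : Vect n) → restrict i g ≋ mvec n W i →
                        ∀ a → toℕ a ≤ toℕ i → g a ≡ kernelGenerator (G n W i) (toℕ i) (toℕ a)
  restriction-entries i g g≋m a a≤i = begin
    g a                                            ≡⟨ cong g inject-a′ ⟨
    restrict i g a′                                ≡⟨ g≋m a′ ⟩
    kernelGenerator (G n W i) (toℕ i) (toℕ a′)     ≡⟨ cong (kernelGenerator (G n W i) (toℕ i)) (Fₚ.toℕ-fromℕ< (s≤s a≤i)) ⟩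
    kernelGenerator (G n W i) (toℕ i) (toℕ a)      ∎
    where
    a′ : Fin (suc (toℕ i))
    a′ = fromℕ< (s≤s a≤i)
    inject-a′ : inject≤ a′ (Fₚ.toℕ<n i) ≡ a
    inject-a′ = Fₚ.toℕ-injective (trans (Fₚ.toℕ-inject≤ a′ (Fₚ.toℕ<n i)) (Fₚ.toℕ-fromℕ< (s≤s a≤i)))
    open ≡-Reasoning

  flowUpClass : ∀ i → ∃ λ M → IsSpline n W M × restrict i M ≋ mvec n W i
  flowUpClass i with G-extend i (kernelGenerator (G n W i) (toℕ i))
                       (kernelGenerator-spline (toℕ i) (G n W i) (G-symmetric i))
  ... | g , g-spline , agree = g ∘ toℕ , IsSplineℕ⇒IsSpline g g-spline ,
          λ a → trans (cong g (Fₚ.toℕ-inject≤ a (Fₚ.toℕ<n i))) (agree (toℕ a) (Fₚ.toℕ<n a))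

  flowUpBasis : ∀ M → (∀ i → IsSpline n W (M i)) → (∀ i → restrict i (M i) ≋ mvec n W i) →
                IsFlowUpBasis n W M × (∀ i → InF n W i (M i))
  flowUpBasis M M-spline M-restricts = T.flowUpBasis , T.M∈F
    where
    M-below : ∀ i a → toℕ a < toℕ i → M i a ≡ 0ℤ
    M-below i a a<i = trans (restriction-entries i (M i) (M-restricts i) a (ℕₚ.<⇒≤ a<i))
                            (update-≢ _ _ (ℕₚ.<⇒≢ a<i))
    M-diag : ∀ i → M i i ≡ + leading i
    M-diag i = trans (restriction-entries i (M i) (M-restricts i) i ℕₚ.≤-refl) (update-≡ (toℕ i) _ _)
    module T = Triangular {W = W} M leading M-spline M-below M-diag
                          (λ i → incidentLcm≢0 (G n W i) (toℕ i)) spline-leading-∣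

theorem4p3 : (n : ℕ) (W : Wt) → IsSimple n W →
    IsoToSum n W
  × (∀ (i : Fin n) → Rank1 (InK n W i))
  × (∀ (i : Fin n) → Generates (InK n W i) (mvec n W i))
  × (∀ (M : Fin n → Vect n) → (∀ i → IsSpline n W (M i)) →
       (∀ i → restrict i (M i) ≋ mvec n W i) →
       IsFlowUpBasis n W M × (∀ i → InF n W i (M i)))
theorem4p3 n W (sym-W , _) =
    Coordinates.isoToSum M⋆ (proj₁ (proj₁ (flowUpBasis M⋆ M⋆-spline M⋆-restricts)))
      (mvec n W) generates (λ i → fromℕ (toℕ i) , mvec-last≢0 i)
  , rank1
  , generates
  , flowUpBasis
  where
  open CollapseSequence sym-W
  M⋆ : Fin n → Vect n
  M⋆ i = proj₁ (flowUpClass i)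
  M⋆-spline : ∀ i → IsSpline n W (M⋆ i)
  M⋆-spline i = proj₁ (proj₂ (flowUpClass i))
  M⋆-restricts : ∀ i → restrict i (M⋆ i) ≋ mvec n W i
  M⋆-restricts i = proj₂ (proj₂ (flowUpClass i))
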